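{- For $(x,y)\in\mathbb{N}\times\mathbb{N}$, there exists $n\ge 0$ with $(x,y)=(s(n),t(n))$ if and only if $x\ge y$, $(x,y)\ne(0,0)$, and $x\equiv y \pmod 2$. Furthermore, for each such pair $(x,y)$ there are at most two $n\ge 0$ with $(s(n),t(n))=(x,y)$.
   Context: Let $(a(n))_{n\ge 0}$ be the Rudin-Shapiro sequence, defined by $a(0)=1$, $a(2n)=a(n)$, $a(2n+1)=(-1)^n a(n)$ for $n\ge 0$. Let $s(n)=\sum_{0\le i\le n} a(i)$ and $t(n)=\sum_{0\le i\le n}(-1)^i a(i)$. Here $\mathbb{N}=\{0,1,2,\dots\}$. -}

module Defs where

open import Data.Nat using (ℕ; zero; suc; _/_; _%_)
open import Data.Integer using (ℤ; +_; -_; _+_)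

sign : ℕ → ℤ
sign n with n % 2
... | zero = + 1
... | suc _ = - (+ 1)

-- Rudin–Shapiro with fuel: a(0)=1, a(2m)=a(m), a(2m+1)=(-1)^m a(m).
-- With fuel ≥ n the fuel never runs out (m = n/2 < n for n ≥ 1).
rsFuel : ℕ → ℕ → ℤ
rsFuel zero    _ = + 1
rsFuel (suc f) zero = + 1
rsFuel (suc f) (suc k) with (suc k) % 2
... | zero  = rsFuel f (suc k / 2)
... | suc _ = sign (suc k / 2) Data.Integer.* rsFuel f (suc k / 2)

a : ℕ → ℤ
a n = rsFuel n n

s : ℕ → ℤ
s zero    = a 0
s (suc n) = s n + a (suc n)

t : ℕ → ℤ
t zero    = a 0
t (suc n) = t n + sign (suc n) Data.Integer.* a (suc n)

-- Write ε n = (-1)^n a(n) and, for each n, y = t(n), 2k = s(n) − t(n). Splitting n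
-- into 2m and 2m+1 expresses (s, t, ε) at n linearly through (s, t, ε) at m, and by
-- induction n ↦ (y, k, ε n) is a bijection from ℕ onto the admissible triples: those
-- with ε = ±1, where y = 0 forces ε = −1 and k = 0 forces ε = 1. Admissibility of
-- (y, k, ε) for some ε amounts to x ≥ y, x ≡ y (mod 2), (x, y) ≠ (0, 0) with
-- x = y + 2k, and the two possible values of ε give the bound of two preimages.
module Submission where

open import Defs
open import Data.Nat using (ℕ; zero; suc; _+_; _*_; _∸_; _≤_; _<_; _≥_; _%_; _/_; z≤n; s≤s)
import Data.Nat.Properties as ℕₚ
open import Data.Nat.DivMod using (m/n≡1+[m∸n]/n; m/n<m)
open import Data.Nat.Induction using (<-rec; <-wellFounded)
import Data.Nat.Tactic.RingSolver as ℕ-Solver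
open import Data.Integer as ℤ using (ℤ; +_; -_; 1ℤ; -1ℤ)
import Data.Integer.Properties as ℤₚ
open import Data.Integer.Tactic.RingSolver using (solve-∀)
import Algebra.Properties.CommutativeSemigroup as CommutativeSemigroupProperties
open import Induction.WellFounded using (Acc; acc; WfRec)
open import Data.Product using (_×_; _,_; ∃-syntax; proj₁; proj₂)
open import Data.Sum as Sum using (_⊎_; inj₁; inj₂)
open import Data.Empty using (⊥-elim)
open import Function.Bundles using (_⇔_; mk⇔)
open import Relation.Binary.PropositionalEquality
open import Relation.Nullary using (¬_)

open ≡-Reasoning

data Parity : ℕ → Set where
  even : ∀ m → Parity (m + m)
  odd  : ∀ m → Parity (suc (m + m))

parity : ∀ n → Parity n
parity zero = even zero
parity (suc n) with parity n
... | even m = odd m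
... | odd m  = subst Parity (cong suc (ℕₚ.+-suc m m)) (even (suc m))

[m+m]%2≡0 : ∀ m → (m + m) % 2 ≡ 0
[m+m]%2≡0 zero = refl
[m+m]%2≡0 (suc m) rewrite ℕₚ.+-suc m m = [m+m]%2≡0 m

[1+m+m]%2≡1 : ∀ m → suc (m + m) % 2 ≡ 1
[1+m+m]%2≡1 zero = refl
[1+m+m]%2≡1 (suc m) rewrite ℕₚ.+-suc m m = [1+m+m]%2≡1 m

[1+n]%2≢n%2 : ∀ n → suc n % 2 ≢ n % 2
[1+n]%2≢n%2 zero = λ ()
[1+n]%2≢n%2 (suc zero) = λ ()
[1+n]%2≢n%2 (suc (suc n)) = [1+n]%2≢n%2 n

[m+n+n]%2≡m%2 : ∀ m n → (m + (n + n)) % 2 ≡ m % 2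
[m+n+n]%2≡m%2 m zero = cong (_% 2) (ℕₚ.+-identityʳ m)
[m+n+n]%2≡m%2 m (suc n)
  rewrite ℕₚ.+-suc n n | ℕₚ.+-suc m (suc (n + n)) | ℕₚ.+-suc m (n + n) = [m+n+n]%2≡m%2 m n

%2≡⇒+double : ∀ {x y} → y ≤ x → x % 2 ≡ y % 2 → ∃[ k ] x ≡ y + (k + k)
%2≡⇒+double {x} {y} y≤x x≡y = split (parity (x ∸ y)) (ℕₚ.m+[n∸m]≡n y≤x)
  where
  split : ∀ {d} → Parity d → y + d ≡ x → ∃[ k ] x ≡ y + (k + k)
  split (even k) y+2k≡x = k , sym y+2k≡x
  split (odd k) y+2k+1≡x = ⊥-elim ([1+n]%2≢n%2 (y + (k + k)) (begin
    suc (y + (k + k)) % 2 ≡⟨ cong (_% 2) (trans (sym (ℕₚ.+-suc y (k + k))) y+2k+1≡x) ⟩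
    x % 2                 ≡⟨ x≡y ⟩
    y % 2                 ≡⟨ [m+n+n]%2≡m%2 y k ⟨
    (y + (k + k)) % 2     ∎))

[2+n]/2≡1+n/2 : ∀ n → suc (suc n) / 2 ≡ suc (n / 2)
[2+n]/2≡1+n/2 n = m/n≡1+[m∸n]/n {suc (suc n)} {2} (s≤s (s≤s z≤n))

[m+m]/2≡m : ∀ m → (m + m) / 2 ≡ m
[m+m]/2≡m zero = refl
[m+m]/2≡m (suc m) rewrite ℕₚ.+-suc m m =
  trans ([2+n]/2≡1+n/2 (m + m)) (cong suc ([m+m]/2≡m m))

[1+m+m]/2≡m : ∀ m → suc (m + m) / 2 ≡ m
[1+m+m]/2≡m zero = refl
[1+m+m]/2≡m (suc m) rewrite ℕₚ.+-suc m m =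
  trans ([2+n]/2≡1+n/2 (suc (m + m))) (cong suc ([1+m+m]/2≡m m))

[1+n]/2≤n : ∀ n → suc n / 2 ≤ n
[1+n]/2≤n n = ℕₚ.≤-pred (m/n<m (suc n) 2 (s≤s (s≤s z≤n)))

IsSign : ℤ → Set
IsSign e = e ≡ 1ℤ ⊎ e ≡ -1ℤ

1≢-1 : 1ℤ ≢ -1ℤ
1≢-1 ()

-‿isSign : ∀ {e} → IsSign e → IsSign (- e)
-‿isSign (inj₁ refl) = inj₂ refl
-‿isSign (inj₂ refl) = inj₁ refl

*-isSign : ∀ {σ e} → IsSign σ → IsSign e → IsSign (σ ℤ.* e)
*-isSign (inj₁ refl) (inj₁ refl) = inj₁ refl
*-isSign (inj₁ refl) (inj₂ refl) = inj₂ refl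
*-isSign (inj₂ refl) (inj₁ refl) = inj₂ refl
*-isSign (inj₂ refl) (inj₂ refl) = inj₁ refl

isSign-*-cancel : ∀ {σ} → IsSign σ → ∀ x → σ ℤ.* (σ ℤ.* x) ≡ x
isSign-*-cancel (inj₁ refl) x = trans (ℤₚ.*-identityˡ _) (ℤₚ.*-identityˡ x)
isSign-*-cancel (inj₂ refl) x =
  trans (ℤₚ.-1*i≡-i _) (trans (cong -_ (ℤₚ.-1*i≡-i x)) (ℤₚ.neg-involutive x))

isSign-≡⊎≡- : ∀ {e σ} → IsSign e → IsSign σ → e ≡ σ ⊎ e ≡ - σ
isSign-≡⊎≡- (inj₁ refl) (inj₁ refl) = inj₁ refl
isSign-≡⊎≡- (inj₁ refl) (inj₂ refl) = inj₂ refl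
isSign-≡⊎≡- (inj₂ refl) (inj₁ refl) = inj₂ refl
isSign-≡⊎≡- (inj₂ refl) (inj₂ refl) = inj₁ refl

isSign-pigeonhole : ∀ {e₁ e₂ e₃} → IsSign e₁ → IsSign e₂ → IsSign e₃ →
                    e₁ ≡ e₂ ⊎ e₁ ≡ e₃ ⊎ e₂ ≡ e₃
isSign-pigeonhole (inj₁ refl) (inj₁ refl) _           = inj₁ refl
isSign-pigeonhole (inj₂ refl) (inj₂ refl) _           = inj₁ refl
isSign-pigeonhole (inj₁ refl) (inj₂ refl) (inj₁ refl) = inj₂ (inj₁ refl)
isSign-pigeonhole (inj₁ refl) (inj₂ refl) (inj₂ refl) = inj₂ (inj₂ refl)
isSign-pigeonhole (inj₂ refl) (inj₁ refl) (inj₁ refl) = inj₂ (inj₂ refl)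
isSign-pigeonhole (inj₂ refl) (inj₁ refl) (inj₂ refl) = inj₂ (inj₁ refl)

sign-suc : ∀ n → sign (suc n) ≡ - sign n
sign-suc zero = refl
sign-suc (suc zero) = refl
sign-suc (suc (suc n)) = sign-suc n

-sign-suc : ∀ n → - sign (suc n) ≡ sign n
-sign-suc n = trans (cong -_ (sign-suc n)) (ℤₚ.neg-involutive (sign n))

sign-double : ∀ m → sign (m + m) ≡ 1ℤ
sign-double zero = refl
sign-double (suc m) rewrite ℕₚ.+-suc m m = sign-double m

sign-1+double : ∀ m → sign (suc (m + m)) ≡ -1ℤ
sign-1+double m = trans (sign-suc (m + m)) (cong -_ (sign-double m))

sign-+-double : ∀ m n → sign (m + (n + n)) ≡ sign m
sign-+-double zero n = sign-double n
sign-+-double (suc m) n =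
  trans (sign-suc (m + (n + n))) (trans (cong -_ (sign-+-double m n)) (sym (sign-suc m)))

sign-isSign : ∀ n → IsSign (sign n)
sign-isSign n with parity n
... | even m = inj₁ (sign-double m)
... | odd m  = inj₂ (sign-1+double m)

-- Recurrences for a, s and t

rsFuel-irrelevant : ∀ {f g} n → n ≤ f → n ≤ g → rsFuel f n ≡ rsFuel g n
rsFuel-irrelevant {zero}  {zero}  zero _ _ = refl
rsFuel-irrelevant {zero}  {suc g} zero _ _ = refl
rsFuel-irrelevant {suc f} {zero}  zero _ _ = refl
rsFuel-irrelevant {suc f} {suc g} zero _ _ = refl
rsFuel-irrelevant {suc f} {suc g} (suc k) (s≤s k≤f) (s≤s k≤g)
  with suc k % 2
     | rsFuel-irrelevant (suc k / 2) (ℕₚ.≤-trans ([1+n]/2≤n k) k≤f) (ℕₚ.≤-trans ([1+n]/2≤n k) k≤g)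
... | zero  | on-half = on-half
... | suc _ | on-half = cong (sign (suc k / 2) ℤ.*_) on-half

rsFuel-isSign : ∀ f n → IsSign (rsFuel f n)
rsFuel-isSign zero n = inj₁ refl
rsFuel-isSign (suc f) zero = inj₁ refl
rsFuel-isSign (suc f) (suc k) with suc k % 2
... | zero  = rsFuel-isSign f (suc k / 2)
... | suc _ = *-isSign (sign-isSign (suc k / 2)) (rsFuel-isSign f (suc k / 2))

a-isSign : ∀ n → IsSign (a n)
a-isSign n = rsFuel-isSign n n

a-unfold-even : ∀ k → suc k % 2 ≡ 0 → a (suc k) ≡ a (suc k / 2)
a-unfold-even k eq rewrite eq = rsFuel-irrelevant (suc k / 2) ([1+n]/2≤n k) ℕₚ.≤-refl

a-unfold-odd : ∀ k → suc k % 2 ≡ 1 → a (suc k) ≡ sign (suc k / 2) ℤ.* a (suc k / 2)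
a-unfold-odd k eq rewrite eq =
  cong (sign (suc k / 2) ℤ.*_) (rsFuel-irrelevant (suc k / 2) ([1+n]/2≤n k) ℕₚ.≤-refl)

a-double : ∀ m → a (m + m) ≡ a m
a-double zero = refl
a-double (suc m) =
  trans (a-unfold-even (m + suc m) ([m+m]%2≡0 (suc m))) (cong a ([m+m]/2≡m (suc m)))

a-1+double : ∀ m → a (suc (m + m)) ≡ sign m ℤ.* a m
a-1+double m =
  trans (a-unfold-odd (m + m) ([1+m+m]%2≡1 m)) (cong (λ h → sign h ℤ.* a h) ([1+m+m]/2≡m m))

-- The summand of t, so that t (suc n) ≡ t n ℤ.+ ε (suc n) holds by definition.
ε : ℕ → ℤ
ε n = sign n ℤ.* a n

ε-isSign : ∀ n → IsSign (ε n)
ε-isSign n = *-isSign (sign-isSign n) (a-isSign n)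

ε-double≡a : ∀ m → ε (m + m) ≡ a m
ε-double≡a m = trans (cong (ℤ._* a (m + m)) (sign-double m)) (trans (ℤₚ.*-identityˡ _) (a-double m))

ε-double : ∀ m → ε (m + m) ≡ sign m ℤ.* ε m
ε-double m = trans (ε-double≡a m) (sym (isSign-*-cancel (sign-isSign m) (a m)))

ε-1+double : ∀ m → ε (suc (m + m)) ≡ - ε m
ε-1+double m = trans (cong₂ ℤ._*_ (sign-1+double m) (a-1+double m)) (ℤₚ.-1*i≡-i (ε m))

module ℤ+ = CommutativeSemigroupProperties ℤₚ.+-commutativeSemigroup

[x+e]-e≡x : ∀ x e → x ℤ.+ e ℤ.- e ≡ x
[x+e]-e≡x = solve-∀

[x-e]+e≡x : ∀ x e → x ℤ.- e ℤ.+ e ≡ x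
[x-e]+e≡x = solve-∀

s-1+double : ∀ m → s (suc (m + m)) ≡ s m ℤ.+ t m
s-1+double zero = refl
s-1+double (suc m) = begin
  s (m + suc m) ℤ.+ a (suc m + suc m) ℤ.+ a (suc (suc m + suc m))
    ≡⟨ cong₂ ℤ._+_ (cong₂ ℤ._+_ (trans (cong s (ℕₚ.+-suc m m)) (s-1+double m)) (a-double (suc m)))
                   (a-1+double (suc m)) ⟩
  s m ℤ.+ t m ℤ.+ a (suc m) ℤ.+ ε (suc m)
    ≡⟨ ℤₚ.+-assoc (s m ℤ.+ t m) (a (suc m)) (ε (suc m)) ⟩
  (s m ℤ.+ t m) ℤ.+ (a (suc m) ℤ.+ ε (suc m))
    ≡⟨ ℤ+.interchange (s m) (t m) (a (suc m)) (ε (suc m)) ⟩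
  (s m ℤ.+ a (suc m)) ℤ.+ (t m ℤ.+ ε (suc m)) ∎

t-1+double : ∀ m → t (suc (m + m)) ≡ s m ℤ.- t m
t-1+double zero = refl
t-1+double (suc m) = begin
  t (m + suc m) ℤ.+ ε (suc m + suc m) ℤ.+ ε (suc (suc m + suc m))
    ≡⟨ cong₂ ℤ._+_ (cong₂ ℤ._+_ (trans (cong t (ℕₚ.+-suc m m)) (t-1+double m)) (ε-double≡a (suc m)))
                   (ε-1+double (suc m)) ⟩
  s m ℤ.- t m ℤ.+ a (suc m) ℤ.+ - ε (suc m)
    ≡⟨ regroup (s m) (t m) (a (suc m)) (ε (suc m)) ⟩
  (s m ℤ.+ a (suc m)) ℤ.- (t m ℤ.+ ε (suc m)) ∎
  where
  regroup : ∀ S T A E → S ℤ.- T ℤ.+ A ℤ.+ - E ≡ (S ℤ.+ A) ℤ.- (T ℤ.+ E)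
  regroup = solve-∀

s-double : ∀ m → s (m + m) ≡ s m ℤ.+ (t m ℤ.- ε m)
s-double m = begin
  s (m + m)                       ≡⟨ [x+e]-e≡x (s (m + m)) (ε m) ⟨
  s (m + m) ℤ.+ ε m ℤ.- ε m       ≡⟨ cong (λ z → s (m + m) ℤ.+ z ℤ.- ε m) (a-1+double m) ⟨
  s (suc (m + m)) ℤ.- ε m         ≡⟨ cong (ℤ._- ε m) (s-1+double m) ⟩
  s m ℤ.+ t m ℤ.- ε m             ≡⟨ ℤₚ.+-assoc (s m) (t m) (- ε m) ⟩
  s m ℤ.+ (t m ℤ.- ε m)           ∎

t-double : ∀ m → t (m + m) ≡ s m ℤ.- (t m ℤ.- ε m)
t-double m = begin
  t (m + m)                       ≡⟨ [x-e]+e≡x (t (m + m)) (ε m) ⟨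
  t (m + m) ℤ.- ε m ℤ.+ ε m       ≡⟨ cong (λ z → t (m + m) ℤ.+ z ℤ.+ ε m) (ε-1+double m) ⟨
  t (suc (m + m)) ℤ.+ ε m         ≡⟨ cong (ℤ._+ ε m) (t-1+double m) ⟩
  s m ℤ.- t m ℤ.+ ε m             ≡⟨ regroup (s m) (t m) (ε m) ⟩
  s m ℤ.- (t m ℤ.- ε m)           ∎
  where
  regroup : ∀ S T E → S ℤ.- T ℤ.+ E ≡ S ℤ.- (T ℤ.- E)
  regroup = solve-∀

record Coords (n y k : ℕ) (e : ℤ) : Set where
  constructor ⟨_,_,_⟩
  field
    s≡ : s n ≡ + (y + (k + k))
    t≡ : t n ≡ + y
    ε≡ : ε n ≡ e

data Admissible : ℕ → ℕ → ℤ → Set where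
  admissible⁺ : ∀ {y k} → Admissible (suc y) k 1ℤ
  admissible⁻ : ∀ {y k} → Admissible y (suc k) -1ℤ

admissible-isSign : ∀ {y k e} → Admissible y k e → IsSign e
admissible-isSign admissible⁺ = inj₁ refl
admissible-isSign admissible⁻ = inj₂ refl

admissible-suc-suc : ∀ {y k e} → IsSign e → Admissible (suc y) (suc k) e
admissible-suc-suc (inj₁ refl) = admissible⁺
admissible-suc-suc (inj₂ refl) = admissible⁻

admissible-swap : ∀ {y k e} → Admissible y k e → Admissible (k + k) y (- e)
admissible-swap admissible⁺ = admissible⁻
admissible-swap admissible⁻ = admissible⁺

admissible-halve : ∀ j {k e} → Admissible (j + j) k e → Admissible k j (- e)
admissible-halve zero    admissible⁻ = admissible⁺
admissible-halve (suc j) admissible⁺ = admissible⁻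
admissible-halve (suc j) admissible⁻ = admissible⁺

admissible⇒0<y+k : ∀ {y k e} → Admissible y k e → 0 < y + k
admissible⇒0<y+k admissible⁺ = s≤s z≤n
admissible⇒0<y+k {y} (admissible⁻ {k = k}) = ℕₚ.<-≤-trans (s≤s z≤n) (ℕₚ.m≤n+m (suc k) y)

≢0⇒admissible : ∀ y k → ¬ (_≡_ {A = ℕ × ℕ} (y + (k + k) , y) (0 , 0)) → ∃[ e ] Admissible y k e
≢0⇒admissible (suc y) k _ = 1ℤ , admissible⁺
≢0⇒admissible zero (suc k) _ = -1ℤ , admissible⁻
≢0⇒admissible zero zero ≢0 = ⊥-elim (≢0 refl)

admissible⇒≢0 : ∀ {y k e} → Admissible y k e → ¬ (_≡_ {A = ℕ × ℕ} (y + (k + k) , y) (0 , 0))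
admissible⇒≢0 admissible⁺ = λ ()
admissible⇒≢0 {y} admissible⁻ = λ eq → ℕₚ.1+n≢0 (ℕₚ.m+n≡0⇒n≡0 y (cong proj₁ eq))

-- ℤ.+ on casts +_ computes to ℕ addition, so ring identities instantiated at + y and
-- + k close goals stated with natural coordinates.
coords-1+double : ∀ {m y k e} → Coords m y k e → Coords (suc (m + m)) (k + k) y (- e)
coords-1+double {m} {y} {k} ⟨ s≡ , t≡ , ε≡ ⟩ =
  ⟨ trans (s-1+double m) (trans (cong₂ ℤ._+_ s≡ t≡) (sum (+ y) (+ k)))
  , trans (t-1+double m) (trans (cong₂ ℤ._-_ s≡ t≡) (difference (+ y) (+ k)))
  , trans (ε-1+double m) (cong -_ ε≡) ⟩
  where
  sum : ∀ Y K → Y ℤ.+ (K ℤ.+ K) ℤ.+ Y ≡ (K ℤ.+ K) ℤ.+ (Y ℤ.+ Y)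
  sum = solve-∀
  difference : ∀ Y K → Y ℤ.+ (K ℤ.+ K) ℤ.- Y ≡ K ℤ.+ K
  difference = solve-∀

coords-double⁺ : ∀ {m y k} → Coords m (suc y) k 1ℤ → Coords (m + m) (suc (k + k)) y (sign m)
coords-double⁺ {m} {y} {k} ⟨ s≡ , t≡ , ε≡ ⟩ =
  ⟨ trans (s-double m) (trans (cong₂ ℤ._+_ s≡ (cong₂ ℤ._-_ t≡ ε≡)) (sum (+ y) (+ k)))
  , trans (t-double m) (trans (cong₂ ℤ._-_ s≡ (cong₂ ℤ._-_ t≡ ε≡)) (difference (+ y) (+ k)))
  , trans (ε-double m) (trans (cong (sign m ℤ.*_) ε≡) (ℤₚ.*-identityʳ (sign m))) ⟩
  where
  sum : ∀ Y K → (1ℤ ℤ.+ Y) ℤ.+ (K ℤ.+ K) ℤ.+ ((1ℤ ℤ.+ Y) ℤ.- 1ℤ) ≡ (1ℤ ℤ.+ (K ℤ.+ K)) ℤ.+ (Y ℤ.+ Y)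
  sum = solve-∀
  difference : ∀ Y K → (1ℤ ℤ.+ Y) ℤ.+ (K ℤ.+ K) ℤ.- ((1ℤ ℤ.+ Y) ℤ.- 1ℤ) ≡ 1ℤ ℤ.+ (K ℤ.+ K)
  difference = solve-∀

coords-double⁻ : ∀ {m y k} → Coords m y (suc k) -1ℤ → Coords (m + m) (suc (k + k)) (suc y) (- sign m)
coords-double⁻ {m} {y} {k} ⟨ s≡ , t≡ , ε≡ ⟩ =
  ⟨ trans (s-double m) (trans (cong₂ ℤ._+_ s≡ (cong₂ ℤ._-_ t≡ ε≡)) (sum (+ y) (+ k)))
  , trans (t-double m) (trans (cong₂ ℤ._-_ s≡ (cong₂ ℤ._-_ t≡ ε≡)) (difference (+ y) (+ k)))
  , trans (ε-double m) (trans (cong (sign m ℤ.*_) ε≡) (times-1 (sign m))) ⟩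
  where
  sum : ∀ Y K → Y ℤ.+ ((1ℤ ℤ.+ K) ℤ.+ (1ℤ ℤ.+ K)) ℤ.+ (Y ℤ.- -1ℤ)
              ≡ (1ℤ ℤ.+ (K ℤ.+ K)) ℤ.+ ((1ℤ ℤ.+ Y) ℤ.+ (1ℤ ℤ.+ Y))
  sum = solve-∀
  difference : ∀ Y K → Y ℤ.+ ((1ℤ ℤ.+ K) ℤ.+ (1ℤ ℤ.+ K)) ℤ.- (Y ℤ.- -1ℤ) ≡ 1ℤ ℤ.+ (K ℤ.+ K)
  difference = solve-∀
  times-1 : ∀ X → X ℤ.* -1ℤ ≡ - X
  times-1 = solve-∀

record Coordinates (n : ℕ) : Set where
  constructor ⟦_,_,_⟧
  field
    {y k}      : ℕ
    {e}        : ℤ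
    coords     : Coords n y k e
    admissible : Admissible y k e
    sign-t     : sign n ≡ - sign y

coordinates-1+double : ∀ {m} → Coordinates m → Coordinates (suc (m + m))
coordinates-1+double {m} (⟦_,_,_⟧ {k = k} c adm _) =
  ⟦ coords-1+double c , admissible-swap adm , trans (sign-1+double m) (cong -_ (sym (sign-double k))) ⟧

coordinates-double : ∀ {m} → Coordinates m → Coordinates (m + m)
coordinates-double {m} (⟦_,_,_⟧ {k = k} c admissible⁺ sign-m) =
  ⟦ coords-double⁺ c , admissible⁺-sign sign-m
  , trans (sign-double m) (cong -_ (sym (sign-1+double k))) ⟧
  where
  admissible⁺-sign : ∀ {y} → sign m ≡ - sign (suc y) → Admissible (suc (k + k)) y (sign m)
  admissible⁺-sign {zero}  sign-m = subst (Admissible _ zero) (sym sign-m) admissible⁺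
  admissible⁺-sign {suc y} _      = admissible-suc-suc (sign-isSign m)
coordinates-double {m} (⟦_,_,_⟧ {k = suc k} c admissible⁻ _) =
  ⟦ coords-double⁻ c , admissible-suc-suc (-‿isSign (sign-isSign m))
  , trans (sign-double m) (cong -_ (sym (sign-1+double k))) ⟧

coordinates : ∀ n → Coordinates n
coordinates = <-rec Coordinates step
  where
  step : ∀ n → (∀ {m} → m < n → Coordinates m) → Coordinates n
  step n rec with parity n
  ... | even zero    = ⟦_,_,_⟧ {k = 0} ⟨ refl , refl , refl ⟩ admissible⁺ refl
  ... | even (suc m) = coordinates-double (rec (ℕₚ.m<m+n (suc m) (s≤s z≤n)))
  ... | odd m        = coordinates-1+double (rec (s≤s (ℕₚ.m≤m+n m m)))

s≡⇒sign : ∀ n {x} → s n ≡ + x → sign n ≡ - sign x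
s≡⇒sign n {x} s≡x = trans sign-t (cong -_ (trans (sym (sign-+-double y k)) (cong sign y+2k≡x)))
  where
  open Coordinates (coordinates n)
  y+2k≡x : y + (k + k) ≡ x
  y+2k≡x = ℤₚ.+-injective (trans (sym (Coords.s≡ coords)) s≡x)

s≡⇒sign≡ : ∀ n n' → s n ≡ s n' → sign n ≡ sign n'
s≡⇒sign≡ n n' s≡s' = trans (s≡⇒sign n s≡) (sym (s≡⇒sign n' (trans (sym s≡s') s≡)))
  where
  open Coordinates (coordinates n)
  open Coords coords

coords⇒sign : ∀ {m y k e} → Coords m y k e → sign m ≡ - sign y
coords⇒sign {m} {y} {k} c = trans (s≡⇒sign m (Coords.s≡ c)) (cong -_ (sign-+-double y k))

-- Surjectivity onto admissible triples

μ : ℕ → ℕ → ℕ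
μ y k = 2 * y + 3 * k

<-by-offset : ∀ {m n} d → 0 < d → m + d ≡ n → m < n
<-by-offset {m} d 0<d m+d≡n = subst (m <_) m+d≡n (ℕₚ.m<m+n m 0<d)

μ-halve : ∀ j k → 0 < k + j → μ k j < μ (j + j) k
μ-halve j k 0<k+j = <-by-offset (k + j) 0<k+j (identity j k)
  where
  identity : ∀ j k → 2 * k + 3 * j + (k + j) ≡ 2 * (j + j) + 3 * k
  identity = ℕ-Solver.solve-∀

μ-double⁺ : ∀ j k → 0 < j + k → μ (suc k) j < μ (suc (j + j)) k
μ-double⁺ j k 0<j+k = <-by-offset (j + k) 0<j+k (identity j k)
  where
  identity : ∀ j k → 2 * (1 + k) + 3 * j + (j + k) ≡ 2 * (1 + (j + j)) + 3 * k
  identity = ℕ-Solver.solve-∀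

μ-double⁻ : ∀ j k → μ k (suc j) < μ (suc (j + j)) (suc k)
μ-double⁻ j k = <-by-offset (suc (suc (j + k))) (s≤s z≤n) (identity j k)
  where
  identity : ∀ j k → 2 * k + 3 * (1 + j) + (2 + (j + k)) ≡ 2 * (1 + (j + j)) + 3 * (1 + k)
  identity = ℕ-Solver.solve-∀

mutual
  preimage : ∀ {y k e} → Admissible y k e → Acc _<_ (μ y k) → ∃[ n ] Coords n y k e
  preimage {y} {k} {e} adm (acc rec) with parity y
  ... | even j =
    let adm′  = admissible-halve j adm
        m , c = preimage adm′ (rec (μ-halve j k (admissible⇒0<y+k adm′)))
    in suc (m + m) , subst (Coords _ (j + j) k) (ℤₚ.neg-involutive e) (coords-1+double c)
  ... | odd j = preimage-odd j k adm rec

  preimage-odd : ∀ j k {e} → Admissible (suc (j + j)) k e → WfRec _<_ (Acc _<_) (μ (suc (j + j)) k) →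
                 ∃[ n ] Coords n (suc (j + j)) k e
  preimage-odd zero    zero admissible⁺ rec = 0 , ⟨ refl , refl , refl ⟩
  preimage-odd (suc j) zero admissible⁺ rec = preimage-double⁺ (suc j) zero refl (s≤s z≤n) rec
  preimage-odd j (suc k) adm rec with isSign-≡⊎≡- (admissible-isSign adm) (sign-isSign k)
  ... | inj₁ e≡sign-k  = preimage-double⁻ j k e≡sign-k rec
  ... | inj₂ e≡-sign-k = preimage-double⁺ j (suc k) (trans e≡-sign-k (sym (sign-suc k)))
                           (ℕₚ.<-≤-trans (s≤s z≤n) (ℕₚ.m≤n+m (suc k) j)) rec

  preimage-double⁺ : ∀ j k {e} → e ≡ sign k → 0 < j + k → WfRec _<_ (Acc _<_) (μ (suc (j + j)) k) →
                     ∃[ n ] Coords n (suc (j + j)) k e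
  preimage-double⁺ j k e≡sign-k 0<j+k rec =
    let m , c = preimage (admissible⁺ {k} {j}) (rec (μ-double⁺ j k 0<j+k))
    in m + m , subst (Coords _ (suc (j + j)) k)
                     (trans (coords⇒sign c) (trans (-sign-suc k) (sym e≡sign-k)))
                     (coords-double⁺ c)

  preimage-double⁻ : ∀ j k {e} → e ≡ sign k → WfRec _<_ (Acc _<_) (μ (suc (j + j)) (suc k)) →
                     ∃[ n ] Coords n (suc (j + j)) (suc k) e
  preimage-double⁻ j k e≡sign-k rec =
    let m , c = preimage (admissible⁻ {k} {j}) (rec (μ-double⁻ j k))
    in m + m , subst (Coords _ (suc (j + j)) (suc k))
                     (trans (cong -_ (coords⇒sign c)) (trans (ℤₚ.neg-involutive (sign k)) (sym e≡sign-k)))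
                     (coords-double⁻ c)

coords-surjective : ∀ {y k e} → Admissible y k e → ∃[ n ] Coords n y k e
coords-surjective {y} {k} adm = preimage adm (<-wellFounded (μ y k))

-- Injectivity

sum-difference-injective : ∀ {a b c d} → a ℤ.+ b ≡ c ℤ.+ d → a ℤ.- b ≡ c ℤ.- d → a ≡ c × b ≡ d
sum-difference-injective {a} {b} {c} {d} +≡ -≡ = a≡c , b≡d
  where
  twice : ∀ x y → + 2 ℤ.* x ≡ x ℤ.+ y ℤ.+ (x ℤ.- y)
  twice = solve-∀
  recover : ∀ x y → x ℤ.+ y ℤ.- x ≡ y
  recover = solve-∀
  a≡c : a ≡ c
  a≡c = ℤₚ.*-cancelˡ-≡ (+ 2) a c (begin
    + 2 ℤ.* a                     ≡⟨ twice a b ⟩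
    a ℤ.+ b ℤ.+ (a ℤ.- b)         ≡⟨ cong₂ ℤ._+_ +≡ -≡ ⟩
    c ℤ.+ d ℤ.+ (c ℤ.- d)         ≡⟨ twice c d ⟨
    + 2 ℤ.* c                     ∎)
  b≡d : b ≡ d
  b≡d = begin
    b                 ≡⟨ recover a b ⟨
    a ℤ.+ b ℤ.- a     ≡⟨ cong₂ ℤ._-_ +≡ a≡c ⟩
    c ℤ.+ d ℤ.- c     ≡⟨ recover c d ⟩
    d                 ∎

ε≡sign*ε-double : ∀ m → ε m ≡ sign m ℤ.* ε (m + m)
ε≡sign*ε-double m =
  trans (sym (isSign-*-cancel (sign-isSign m) (ε m))) (cong (sign m ℤ.*_) (sym (ε-double m)))

_≋_ : ℕ → ℕ → Set
n ≋ n' = s n ≡ s n' × t n ≡ t n' × ε n ≡ ε n'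

s-double≢s-1+double : ∀ m m' → s (m + m) ≢ s (suc (m' + m'))
s-double≢s-1+double m m' s≡ =
  1≢-1 (trans (sym (sign-double m))
              (trans (s≡⇒sign≡ (m + m) (suc (m' + m')) s≡) (sign-1+double m')))

≋-1+double⁻¹ : ∀ m m' → suc (m + m) ≋ suc (m' + m') → m ≋ m'
≋-1+double⁻¹ m m' (s≡ , t≡ , ε≡) =
  let sₘ≡ , tₘ≡ = sum-difference-injective (trans (sym (s-1+double m)) (trans s≡ (s-1+double m')))
                                           (trans (sym (t-1+double m)) (trans t≡ (t-1+double m')))
  in sₘ≡ , tₘ≡ , ℤₚ.neg-injective (trans (sym (ε-1+double m)) (trans ε≡ (ε-1+double m')))

≋-double⁻¹ : ∀ m m' → (m + m) ≋ (m' + m') → m ≋ m'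
≋-double⁻¹ m m' (s≡ , t≡ , ε≡) = sₘ≡ , tₘ≡ , εₘ≡
  where
  halves : s m ≡ s m' × t m ℤ.- ε m ≡ t m' ℤ.- ε m'
  halves = sum-difference-injective (trans (sym (s-double m)) (trans s≡ (s-double m')))
                                    (trans (sym (t-double m)) (trans t≡ (t-double m')))
  sₘ≡ : s m ≡ s m'
  sₘ≡ = proj₁ halves
  εₘ≡ : ε m ≡ ε m'
  εₘ≡ = begin
    ε m                       ≡⟨ ε≡sign*ε-double m ⟩
    sign m ℤ.* ε (m + m)      ≡⟨ cong₂ ℤ._*_ (s≡⇒sign≡ m m' sₘ≡) ε≡ ⟩
    sign m' ℤ.* ε (m' + m')   ≡⟨ ε≡sign*ε-double m' ⟨
    ε m'                      ∎
  tₘ≡ : t m ≡ t m'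
  tₘ≡ = begin
    t m                       ≡⟨ [x-e]+e≡x (t m) (ε m) ⟨
    t m ℤ.- ε m ℤ.+ ε m       ≡⟨ cong₂ ℤ._+_ (proj₂ halves) εₘ≡ ⟩
    t m' ℤ.- ε m' ℤ.+ ε m'    ≡⟨ [x-e]+e≡x (t m') (ε m') ⟩
    t m'                      ∎

module ℕ+ = CommutativeSemigroupProperties ℕₚ.+-commutativeSemigroup

halves-<-double : ∀ m m' → 0 < m + m' → m + m' < (m + m) + (m' + m')
halves-<-double m m' 0<m+m' = subst (m + m' <_) (ℕ+.interchange m m' m m') (ℕₚ.m<m+n (m + m') 0<m+m')

halves-<-1+double : ∀ m m' → m + m' < suc (m + m) + suc (m' + m')
halves-<-1+double m m' = s≤s (ℕₚ.≤-trans (ℕₚ.+-mono-≤ (ℕₚ.m≤m+n m m) (ℕₚ.m≤m+n m' m'))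
                                        (ℕₚ.+-monoʳ-≤ (m + m) (ℕₚ.n≤1+n (m' + m'))))

mutual
  ≋⇒≡-acc : ∀ {n n'} → Parity n → Parity n' → Acc _<_ (n + n') → n ≋ n' → n ≡ n'
  ≋⇒≡-acc (even m) (odd m') _ (s≡ , _) = ⊥-elim (s-double≢s-1+double m m' s≡)
  ≋⇒≡-acc (odd m) (even m') _ (s≡ , _) = ⊥-elim (s-double≢s-1+double m' m (sym s≡))
  ≋⇒≡-acc (odd m) (odd m') (acc rec) ≋ = cong (λ h → suc (h + h))
    (≋⇒≡-acc (parity m) (parity m') (rec (halves-<-1+double m m')) (≋-1+double⁻¹ m m' ≋))
  ≋⇒≡-acc (even zero)    (even zero)     _  _ = refl
  ≋⇒≡-acc (even zero)    (even (suc m')) wf ≋ = ≋-double⇒≡ zero (suc m') (s≤s z≤n) wf ≋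
  ≋⇒≡-acc (even (suc m)) (even m')       wf ≋ = ≋-double⇒≡ (suc m) m' (s≤s z≤n) wf ≋

  ≋-double⇒≡ : ∀ m m' → 0 < m + m' → Acc _<_ ((m + m) + (m' + m')) →
               (m + m) ≋ (m' + m') → m + m ≡ m' + m'
  ≋-double⇒≡ m m' 0<m+m' (acc rec) ≋ = cong (λ h → h + h)
    (≋⇒≡-acc (parity m) (parity m') (rec (halves-<-double m m' 0<m+m')) (≋-double⁻¹ m m' ≋))

≋⇒≡ : ∀ {n n'} → n ≋ n' → n ≡ n'
≋⇒≡ {n} {n'} = ≋⇒≡-acc (parity n) (parity n') (<-wellFounded (n + n'))

attained⇒conditions : ∀ {x y} → ∃[ n ] (s n ≡ + x × t n ≡ + y) →
                      x ≥ y × ¬ (_≡_ {A = ℕ × ℕ} (x , y) (0 , 0)) × x % 2 ≡ y % 2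
attained⇒conditions (n , s≡x , t≡y) with coordinates n
... | ⟦_,_,_⟧ {y} {k} ⟨ s≡ , t≡ , _ ⟩ adm _
    with ℤₚ.+-injective (trans (sym s≡) s≡x) | ℤₚ.+-injective (trans (sym t≡) t≡y)
... | refl | refl = ℕₚ.m≤m+n y (k + k) , admissible⇒≢0 adm , [m+n+n]%2≡m%2 y k

conditions⇒attained : ∀ {x y} → x ≥ y × ¬ (_≡_ {A = ℕ × ℕ} (x , y) (0 , 0)) × x % 2 ≡ y % 2 →
                      ∃[ n ] (s n ≡ + x × t n ≡ + y)
conditions⇒attained {y = y} (y≤x , ≢0 , x≡y) with %2≡⇒+double y≤x x≡y
... | k , refl with ≢0⇒admissible y k ≢0
... | _ , adm with coords-surjective adm
... | n , ⟨ s≡ , t≡ , _ ⟩ = n , s≡ , t≡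

theorem31 : ((x y : ℕ) →
                 (∃[ n ] ((s n ≡ + x) × (t n ≡ + y)))
                   ⇔ ((x ≥ y) × (¬ ((x , y) ≡ (0 , 0))) × (x % 2 ≡ y % 2)))
              × ((x y n₁ n₂ n₃ : ℕ) →
                 s n₁ ≡ + x → t n₁ ≡ + y →
                 s n₂ ≡ + x → t n₂ ≡ + y →
                 s n₃ ≡ + x → t n₃ ≡ + y →
                 (n₁ ≡ n₂) ⊎ (n₁ ≡ n₃) ⊎ (n₂ ≡ n₃))
theorem31 = (λ x y → mk⇔ attained⇒conditions conditions⇒attained) , at-most-two
  where
  at-most-two : (x y n₁ n₂ n₃ : ℕ) →
                s n₁ ≡ + x → t n₁ ≡ + y → s n₂ ≡ + x → t n₂ ≡ + y → s n₃ ≡ + x → t n₃ ≡ + y →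
                (n₁ ≡ n₂) ⊎ (n₁ ≡ n₃) ⊎ (n₂ ≡ n₃)
  at-most-two x y n₁ n₂ n₃ s₁ t₁ s₂ t₂ s₃ t₃ =
    Sum.map (same s₁ t₁ s₂ t₂) (Sum.map (same s₁ t₁ s₃ t₃) (same s₂ t₂ s₃ t₃))
            (isSign-pigeonhole (ε-isSign n₁) (ε-isSign n₂) (ε-isSign n₃))
    where
    same : ∀ {i j} → s i ≡ + x → t i ≡ + y → s j ≡ + x → t j ≡ + y → ε i ≡ ε j → i ≡ j
    same sᵢ tᵢ sⱼ tⱼ ε≡ = ≋⇒≡ (trans sᵢ (sym sⱼ) , trans tᵢ (sym tⱼ) , ε≡)
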